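{- Let $\mathcal W$ be a small category and regard the presheaf category $\widehat{\mathcal W}$ as a category with families (CwF) in the standard way described in the context. Then $\widehat{\mathcal W}$ supports welding, in the following sense. There are operations such that: (1) for every context $\Gamma$, every proposition $\Gamma \vdash P$, every type $\Gamma\vdash A$, every type $\Gamma.P \vdash T$ and every term $\Gamma.P \vdash f : A[\pi] \to T$, there is a type $\Gamma \vdash \Omega := \mathrm{Weld}\{A \leftarrow (P \hookrightarrow T, f)\}$; (2) for every term $\Gamma \vdash a : A$ there is a term $\Gamma \vdash \mathrm{weld}_{(P,f)}\,a : \Omega$; (3) for every type $\Gamma.\Omega \vdash C$, every term $\Gamma.P.T \vdash d : C[\pi_P{+}]$ (where $\pi_P{+} = (\pi_P\pi_T,\xi) : \Gamma.P.T \to \Gamma.\Omega$), every term $\Gamma.A \vdash c : C[(\pi_A, \mathrm{weld}_{(P[\pi_A], f[\pi_A{+}])}\,\xi)]$, such that on the context $\Gamma.P.A[\pi_P]$ we have $d[(\pi_A, f[\pi_A]\,\xi)] = c[\pi_P{+}]$, and every term $\Gamma\vdash b : \Omega$, there is a term $\Gamma \vdash \mathrm{ind}_{\mathrm{Weld}}(C, d, c, b) : C[(\mathrm{id}, b)]$; all three operations commute with substitution (naturality in $\Gamma$), and the following equations hold, where $\top$ denotes the proposition with $\top[\gamma] = \{\star\}$ for all $\gamma$: $\mathrm{Weld}\{A \leftarrow (\top \hookrightarrow T, f)\} = T[(\mathrm{id},\star)]$; $\mathrm{weld}_{(\top,f)}\,a = f[(\mathrm{id},\star)]\,a$; $\mathrm{ind}_{\mathrm{Weld}}(C,d,c,b)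 = d[(\mathrm{id},\star,b)]$ when $P=\top$; and $\mathrm{ind}_{\mathrm{Weld}}(C, d, c, \mathrm{weld}_{(P,f)}\,a) = c[(\mathrm{id}, a)]$.
   Context: The presheaf CwF on a small category $\mathcal W$: contexts are presheaves $\Gamma:\mathcal W^{op}\to\mathrm{Set}$; for $W\in\mathcal W$ elements $\gamma\in\Gamma(W)$ are called defining substitutions, and for $\varphi:V\to W$ we write $\gamma\varphi := \Gamma(\varphi)(\gamma)$. Substitutions $\sigma:\Delta\to\Gamma$ are natural transformations. A type $\Gamma\vdash T$ assigns to each $W$ and $\gamma\in\Gamma(W)$ a set $T[\gamma]$ and to each $\varphi:V\to W$ a restriction map $t\mapsto t\langle\varphi\rangle : T[\gamma]\to T[\gamma\varphi]$, functorially. Substitution: $T[\sigma][\delta]:=T[\sigma\delta]$ with the same restrictions. A term $\Gamma\vdash t:T$ is a family $t[\gamma]\in T[\gamma]$ with $t[\gamma]\langle\varphi\rangle = t[\gamma\varphi]$; $t[\sigma][\delta] := t[\sigma\delta]$. The empty context is the terminal presheaf. Context extension: $(\Gamma.T)(W) = \{(\gamma,t) : \gamma\in\Gamma(W), t\in T[\gamma]\}$ with $(\gamma,t)\varphi = (\gamma\varphi, t\langle\varphi\rangle)$, projection $\pi(\gamma,t)=\gamma$ and variable term $\xi[(\gamma,t)]=t$; $(\sigma, t)$ denotes the substitution $\delta\mapsto(\sigma\delta,t[\delta])$ and $\sigma{+} = (\sigma\pi,\xi)$. A type $P$ is a proposition if $P[\gamma]\subseteq\{\star\}$ for all $\gamma$.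 Function types $A\to B$ are the standard presheaf (dependent) function types, with application written $f\,a$. -}

module Defs where

open import Data.Product using (Σ; _,_; proj₁; proj₂)
open import Relation.Binary.PropositionalEquality
  using (_≡_; refl; sym; trans; cong; subst)
open import Relation.Binary.HeterogeneousEquality using (_≅_)
open import Relation.Nullary using (Dec)

record Category : Set₁ where
  infixr 9 _∘_
  field
    Ob    : Set
    Hom   : Ob → Ob → Set
    idH   : ∀ {W} → Hom W W
    _∘_   : ∀ {U V W} → Hom V W → Hom U V → Hom U W
    idˡ   : ∀ {V W} (φ : Hom V W) → idH ∘ φ ≡ φ
    idʳ   : ∀ {V W} (φ : Hom V W) → φ ∘ idH ≡ φ
    assoc : ∀ {T U V W} (φ : Hom V W) (ψ : Hom U V) (χ : Hom T U) →
            (φ ∘ ψ) ∘ χ ≡ φ ∘ (ψ ∘ χ)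

isProp : Set → Set
isProp X = (x y : X) → x ≡ y

-- excluded middle for propositions (the paper's metatheory is classical)
LEM : Set₁
LEM = (X : Set) → isProp X → Dec X

coe : {X Y : Set} → X ≡ Y → X → Y
coe = subst (λ X → X)

coe-sym-coe : {X Y : Set} (p : X ≡ Y) (x : X) → coe (sym p) (coe p x) ≡ x
coe-sym-coe refl x = refl

coe-coe-sym : {X Y : Set} (p : X ≡ Y) (y : Y) → coe p (coe (sym p) y) ≡ y
coe-coe-sym refl y = refl

coe-trans : {X Y Z : Set} (p : X ≡ Y) (q : Y ≡ Z) (x : X) →
            coe (trans p q) x ≡ coe q (coe p x)
coe-trans refl refl x = refl

Σ≡ : {A : Set} {B : A → Set} {a a' : A} (p : a ≡ a') {b : B a} {b' : B a'} →
     subst B p b ≡ b' → _≡_ {A = Σ A B} (a , b) (a' , b')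
Σ≡ refl refl = refl

module PSh (𝒲 : Category) where
  open Category 𝒲

  -- contexts: presheaves;  rst γ φ = γφ
  record Ctx : Set₁ where
    field
      El     : Ob → Set
      rst    : ∀ {V W} → El W → Hom V W → El V
      rst-id : ∀ {W} (γ : El W) → rst γ idH ≡ γ
      rst-∘  : ∀ {U V W} (γ : El W) (φ : Hom V W) (ψ : Hom U V) →
               rst γ (φ ∘ ψ) ≡ rst (rst γ φ) ψ
  open Ctx public

  record Sub (Δ Γ : Ctx) : Set where
    field
      ap   : ∀ {W} → El Δ W → El Γ W
      snat : ∀ {V W} (δ : El Δ W) (φ : Hom V W) → ap (rst Δ δ φ) ≡ rst Γ (ap δ) φ
  open Sub public

  -- types.  res φ e t = t⟨φ⟩, stated for any γ' with (irrelevant) γ' ≡ γφ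
  record Ty (Γ : Ctx) : Set₁ where
    field
      Fam    : ∀ {W} → El Γ W → Set
      res    : ∀ {V W} (φ : Hom V W) {γ : El Γ W} {γ' : El Γ V} →
               .(γ' ≡ rst Γ γ φ) → Fam γ → Fam γ'
      res-id : ∀ {W} {γ : El Γ W} .(e : γ ≡ rst Γ γ idH) (t : Fam γ) → res idH e t ≡ t
      res-∘  : ∀ {U V W} (φ : Hom V W) (ψ : Hom U V)
               {γ : El Γ W} {γ₁ : El Γ V} {γ₂ : El Γ U}
               .(e₁ : γ₁ ≡ rst Γ γ φ) .(e₂ : γ₂ ≡ rst Γ γ₁ ψ) .(e : γ₂ ≡ rst Γ γ (φ ∘ ψ))
               (t : Fam γ) → res (φ ∘ ψ) e t ≡ res ψ e₂ (res φ e₁ t)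
  open Ty public

  record Tm (Γ : Ctx) (T : Ty Γ) : Set where
    field
      tm   : ∀ {W} (γ : El Γ W) → Fam T γ
      tnat : ∀ {V W} (φ : Hom V W) {γ : El Γ W} {γ' : El Γ V} (e : γ' ≡ rst Γ γ φ) →
             res T φ e (tm γ) ≡ tm γ'
  open Tm public

  record PTy (Γ : Ctx) : Set₁ where
    field
      ty   : Ty Γ
      prop : ∀ {W} (γ : El Γ W) → isProp (Fam ty γ)
  open PTy public

  infix 4 _≡ᵀ_ _≅ᵗ_

  record _≡ᵀ_ {Γ : Ctx} (A B : Ty Γ) : Set₁ where
    field
      Fam≡ : ∀ {W} (γ : El Γ W) → Fam A γ ≡ Fam B γ
      res≡ : ∀ {V W} (φ : Hom V W) {γ : El Γ W} {γ' : El Γ V} .(e : γ' ≡ rst Γ γ φ)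
             (x : Fam A γ) → coe (Fam≡ γ') (res A φ e x) ≡ res B φ e (coe (Fam≡ γ) x)
  open _≡ᵀ_ public

  -- equality of terms (pointwise; the types may be (strictly) equal but different)
  _≅ᵗ_ : ∀ {Γ} {A B : Ty Γ} → Tm Γ A → Tm Γ B → Set
  _≅ᵗ_ {Γ} s t = ∀ {W} (γ : El Γ W) → tm s γ ≅ tm t γ

  idS : ∀ {Γ} → Sub Γ Γ
  idS = record { ap = λ γ → γ ; snat = λ δ φ → refl }

  infixl 10 _[_]T _[_]t _[_]P _[_]F

  _[_]T : ∀ {Γ Δ} → Ty Γ → Sub Δ Γ → Ty Δ
  T [ σ ]T = record
    { Fam    = λ δ → Fam T (ap σ δ)
    ; res    = λ φ {δ} .e t → res T φ (trans (cong (ap σ) e) (snat σ δ φ)) t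
    ; res-id = λ {W} {δ} .e t → res-id T (trans (cong (ap σ) e) (snat σ δ idH)) t
    ; res-∘  = λ φ ψ {δ} {δ₁} {δ₂} .e₁ .e₂ .e t →
                 res-∘ T φ ψ (trans (cong (ap σ) e₁) (snat σ δ φ))
                             (trans (cong (ap σ) e₂) (snat σ δ₁ ψ))
                             (trans (cong (ap σ) e) (snat σ δ (φ ∘ ψ))) t
    }

  _[_]t : ∀ {Γ Δ} {T : Ty Γ} → Tm Γ T → (σ : Sub Δ Γ) → Tm Δ (T [ σ ]T)
  t [ σ ]t = record
    { tm   = λ δ → tm t (ap σ δ)
    ; tnat = λ φ {δ} e → tnat t φ (trans (cong (ap σ) e) (snat σ δ φ)) }

  _[_]P : ∀ {Γ Δ} → PTy Γ → Sub Δ Γ → PTy Δ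
  P [ σ ]P = record { ty = ty P [ σ ]T ; prop = λ δ → prop P (ap σ δ) }

  module _ {Γ : Ctx} (T : Ty Γ) where
    subst-res : ∀ {V W} {φ : Hom V W} {γ : El Γ W} {γ' γ'' : El Γ V} (p : γ' ≡ γ'')
                .(e : γ' ≡ rst Γ γ φ) .(e' : γ'' ≡ rst Γ γ φ) (x : Fam T γ) →
                subst (Fam T) p (res T φ e x) ≡ res T φ e' x
    subst-res refl e e' x = refl

    private
      lem-id : ∀ {W} {γ γ₁ : El Γ W} (p : γ₁ ≡ γ) .(e : γ₁ ≡ rst Γ γ idH) (t : Fam T γ) →
               subst (Fam T) p (res T idH e t) ≡ t
      lem-id refl e t = res-id T e t

      lem-∘ : ∀ {U V W} (φ : Hom V W) (ψ : Hom U V) {γ : El Γ W} {γ₁ : El Γ V}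
              {γ₂ γ₂' : El Γ U} (p : γ₂ ≡ γ₂')
              .(e : γ₂ ≡ rst Γ γ (φ ∘ ψ)) .(e₂ : γ₂' ≡ rst Γ γ₁ ψ) .(e₁ : γ₁ ≡ rst Γ γ φ)
              (t : Fam T γ) →
              subst (Fam T) p (res T (φ ∘ ψ) e t) ≡ res T ψ e₂ (res T φ e₁ t)
      lem-∘ φ ψ refl e e₂ e₁ t = res-∘ T φ ψ e₁ e₂ e t

    ext : Ctx
    ext = record
      { El     = λ W → Σ (El Γ W) (Fam T)
      ; rst    = λ x φ → (rst Γ (proj₁ x) φ , res T φ refl (proj₂ x))
      ; rst-id = λ x → Σ≡ (rst-id Γ (proj₁ x)) (lem-id (rst-id Γ (proj₁ x)) refl (proj₂ x))
      ; rst-∘  = λ x φ ψ → Σ≡ (rst-∘ Γ (proj₁ x) φ ψ)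
                    (lem-∘ φ ψ (rst-∘ Γ (proj₁ x) φ ψ) refl refl refl (proj₂ x))
      }

  infixl 5 _▹_
  _▹_ : (Γ : Ctx) → Ty Γ → Ctx
  Γ ▹ T = ext T

  π : ∀ {Γ} (T : Ty Γ) → Sub (Γ ▹ T) Γ
  π T = record { ap = proj₁ ; snat = λ δ φ → refl }

  ξ : ∀ {Γ} (T : Ty Γ) → Tm (Γ ▹ T) (T [ π T ]T)
  ξ T = record { tm = proj₂ ; tnat = λ { φ refl → refl } }

  ⟨_,_⟩ : ∀ {Γ Δ} {T : Ty Γ} (σ : Sub Δ Γ) → Tm Δ (T [ σ ]T) → Sub Δ (Γ ▹ T)
  ⟨_,_⟩ {Γ} {Δ} {T} σ t = record
    { ap   = λ δ → (ap σ δ , tm t δ)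
    ; snat = λ δ φ → Σ≡ (snat σ δ φ)
        (trans (cong (subst (Fam T) (snat σ δ φ)) (sym (tnat t φ refl)))
               (subst-res T (snat σ δ φ) _ refl (tm t δ)))
    }

  lift : ∀ {Γ Δ} (σ : Sub Δ Γ) (T : Ty Γ) → Sub (Δ ▹ T [ σ ]T) (Γ ▹ T)
  lift σ T = record
    { ap   = λ x → (ap σ (proj₁ x) , proj₂ x)
    ; snat = λ x φ → Σ≡ (snat σ (proj₁ x) φ) (subst-res T (snat σ (proj₁ x) φ) _ refl (proj₂ x))
    }

  ≡ᵀ-sym : ∀ {Γ} {A B : Ty Γ} → A ≡ᵀ B → B ≡ᵀ A
  ≡ᵀ-sym {Γ} {A} {B} E = record
    { Fam≡ = λ γ → sym (Fam≡ E γ)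
    ; res≡ = λ φ {γ} {γ'} .e y →
        trans (cong (λ z → coe (sym (Fam≡ E γ')) (res B φ e z))
                    (sym (coe-coe-sym (Fam≡ E γ) y)))
        (trans (cong (coe (sym (Fam≡ E γ'))) (sym (res≡ E φ e (coe (sym (Fam≡ E γ)) y))))
               (coe-sym-coe (Fam≡ E γ') _))
    }

  ≡ᵀ-trans : ∀ {Γ} {A B C : Ty Γ} → A ≡ᵀ B → B ≡ᵀ C → A ≡ᵀ C
  ≡ᵀ-trans {Γ} {A} {B} {C} E F = record
    { Fam≡ = λ γ → trans (Fam≡ E γ) (Fam≡ F γ)
    ; res≡ = λ φ {γ} {γ'} .e x →
        trans (coe-trans (Fam≡ E γ') (Fam≡ F γ') (res A φ e x))
        (trans (cong (coe (Fam≡ F γ')) (res≡ E φ e x))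
        (trans (res≡ F φ e (coe (Fam≡ E γ) x))
               (cong (res C φ e) (sym (coe-trans (Fam≡ E γ) (Fam≡ F γ) x)))))
    }

  coeTm : ∀ {Γ} {A B : Ty Γ} → A ≡ᵀ B → Tm Γ A → Tm Γ B
  coeTm E a = record
    { tm   = λ γ → coe (Fam≡ E γ) (tm a γ)
    ; tnat = λ φ {γ} {γ'} e → trans (sym (res≡ E φ e (tm a γ)))
                                    (cong (coe (Fam≡ E γ')) (tnat a φ e)) }

  liftE : ∀ {Γ Δ} (σ : Sub Δ Γ) {A : Ty Γ} {B : Ty Δ} → A [ σ ]T ≡ᵀ B → Sub (Δ ▹ B) (Γ ▹ A)
  liftE σ {A} {B} E = record
    { ap   = λ x → (ap σ (proj₁ x) , coe (sym (Fam≡ E (proj₁ x))) (proj₂ x))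
    ; snat = λ x φ → Σ≡ (snat σ (proj₁ x) φ)
        (trans (cong (subst (Fam A) (snat σ (proj₁ x) φ)) (res≡ (≡ᵀ-sym E) φ refl (proj₂ x)))
               (subst-res A (snat σ (proj₁ x) φ) _ refl _))
    }

  -- Terms of function type  Γ ⊢ f : A → B  (presheaf function type, unfolded):
  -- an element of (A → B)[γ] is a natural family of maps A[γφ] → B[γφ].

  record FunEl {Γ : Ctx} (A B : Ty Γ) {W : Ob} (γ : El Γ W) : Set where
    field
      fn   : ∀ {V} (φ : Hom V W) {γ' : El Γ V} .(e : γ' ≡ rst Γ γ φ) → Fam A γ' → Fam B γ'
      fnat : ∀ {U V} (φ : Hom V W) (ψ : Hom U V) {γ₁ : El Γ V} {γ₂ : El Γ U}
             (e₁ : γ₁ ≡ rst Γ γ φ) (e₂ : γ₂ ≡ rst Γ γ₁ ψ) (e : γ₂ ≡ rst Γ γ (φ ∘ ψ))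
             (a : Fam A γ₁) → res B ψ e₂ (fn φ e₁ a) ≡ fn (φ ∘ ψ) e (res A ψ e₂ a)
  open FunEl public

  -- terms:  f[γ]⟨ψ⟩ = f[γψ]
  record FTm (Γ : Ctx) (A B : Ty Γ) : Set where
    field
      ftm   : ∀ {W} (γ : El Γ W) → FunEl A B γ
      ftnat : ∀ {V W} (ψ : Hom V W) {γ : El Γ W} {γ' : El Γ V} (e₀ : γ' ≡ rst Γ γ ψ)
              {U} (χ : Hom U V) {γ'' : El Γ U}
              (e : γ'' ≡ rst Γ γ' χ) (e' : γ'' ≡ rst Γ γ (ψ ∘ χ)) (a : Fam A γ'') →
              fn (ftm γ') χ e a ≡ fn (ftm γ) (ψ ∘ χ) e' a
  open FTm public

  _[_]F : ∀ {Γ Δ} {A B : Ty Γ} → FTm Γ A B → (σ : Sub Δ Γ) → FTm Δ (A [ σ ]T) (B [ σ ]T)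
  f [ σ ]F = record
    { ftm = λ δ → record
        { fn   = λ φ .e a → fn (ftm f (ap σ δ)) φ (trans (cong (ap σ) e) (snat σ δ φ)) a
        ; fnat = λ φ ψ {δ₁} e₁ e₂ e a →
            fnat (ftm f (ap σ δ)) φ ψ (trans (cong (ap σ) e₁) (snat σ δ φ))
                 (trans (cong (ap σ) e₂) (snat σ δ₁ ψ))
                 (trans (cong (ap σ) e) (snat σ δ (φ ∘ ψ))) a }
    ; ftnat = λ ψ {δ} {δ'} e₀ χ e e' a →
        ftnat f ψ (trans (cong (ap σ) e₀) (snat σ δ ψ)) χ
              (trans (cong (ap σ) e) (snat σ δ' χ))
              (trans (cong (ap σ) e') (snat σ δ (ψ ∘ χ))) a
    }

  private
    fn-cong : ∀ {Γ} {A B : Ty Γ} {W} {γ : El Γ W} (g : FunEl A B γ) {V} {φ φ' : Hom V W}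
              (p : φ ≡ φ') {γ' : El Γ V} .(e : γ' ≡ rst Γ γ φ) .(e' : γ' ≡ rst Γ γ φ')
              (x : Fam A γ') → fn g φ e x ≡ fn g φ' e' x
    fn-cong g refl e e' x = refl

  infixl 8 _$_
  _$_ : ∀ {Γ} {A B : Ty Γ} → FTm Γ A B → Tm Γ A → Tm Γ B
  _$_ {Γ} {A} {B} f a = record
    { tm   = λ γ → fn (ftm f γ) idH (sym (rst-id Γ γ)) (tm a γ)
    ; tnat = λ φ {γ} {γ'} e →
        let e₁ = trans e (cong (rst Γ γ) (sym (idˡ φ)))
            e₂ = trans e (cong (rst Γ γ) (sym (idʳ φ)))
        in trans (fnat (ftm f γ) idH φ (sym (rst-id Γ γ)) e e₁ (tm a γ))
           (trans (cong (fn (ftm f γ) (idH ∘ φ) e₁) (tnat a φ e))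
           (trans (fn-cong (ftm f γ) (idˡ φ) e₁ e (tm a γ'))
           (trans (fn-cong (ftm f γ) (sym (idʳ φ)) e e₂ (tm a γ'))
                  (sym (ftnat f φ e idH (sym (rst-id Γ γ')) e₂ (tm a γ'))))))
    }

  -- (1) the type former Weld{A ← (P ↪ T, f)}, its naturality and its ⊤-rule.
  -- The ⊤-rule is stated for every P that has a term p : Γ ⊢ P.
  record WeldType : Set₁ where
    field
      Weld     : ∀ {Γ} (P : PTy Γ) (A : Ty Γ) (T : Ty (Γ ▹ ty P))
                 (f : FTm (Γ ▹ ty P) (A [ π (ty P) ]T) T) → Ty Γ
      Weld-nat : ∀ {Γ Δ} (σ : Sub Δ Γ) (P : PTy Γ) (A : Ty Γ) (T : Ty (Γ ▹ ty P))
                 (f : FTm (Γ ▹ ty P) (A [ π (ty P) ]T) T) →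
                 Weld P A T f [ σ ]T
                   ≡ᵀ Weld (P [ σ ]P) (A [ σ ]T) (T [ lift σ (ty P) ]T) (f [ lift σ (ty P) ]F)
      Weld-⊤   : ∀ {Γ} (P : PTy Γ) (A : Ty Γ) (T : Ty (Γ ▹ ty P))
                 (f : FTm (Γ ▹ ty P) (A [ π (ty P) ]T) T) (p : Tm Γ (ty P)) →
                 Weld P A T f ≡ᵀ T [ ⟨ idS , p ⟩ ]T

  module WeldAux (WT : WeldType) where
    open WeldType WT

    -- Ω[π_P] = T  on Γ.P  (naturality along π_P followed by the ⊤-rule with p = ξ)
    Ω[π]≡T : ∀ {Γ} (P : PTy Γ) (A : Ty Γ) (T : Ty (Γ ▹ ty P))
             (f : FTm (Γ ▹ ty P) (A [ π (ty P) ]T) T) → Weld P A T f [ π (ty P) ]T ≡ᵀ T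
    Ω[π]≡T P A T f =
      ≡ᵀ-trans (Weld-nat (π (ty P)) P A T f)
               (Weld-⊤ (P [ π (ty P) ]P) (A [ π (ty P) ]T) (T [ lift (π (ty P)) (ty P) ]T)
                       (f [ lift (π (ty P)) (ty P) ]F) (ξ (ty P)))

    πP⁺ : ∀ {Γ} (P : PTy Γ) (A : Ty Γ) (T : Ty (Γ ▹ ty P))
          (f : FTm (Γ ▹ ty P) (A [ π (ty P) ]T) T) → Sub (Γ ▹ ty P ▹ T) (Γ ▹ Weld P A T f)
    πP⁺ P A T f = liftE (π (ty P)) (Ω[π]≡T P A T f)

  record WeldTm (WT : WeldType) : Set₁ where
    open WeldType WT
    field
      weld     : ∀ {Γ} (P : PTy Γ) (A : Ty Γ) (T : Ty (Γ ▹ ty P))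
                 (f : FTm (Γ ▹ ty P) (A [ π (ty P) ]T) T) → Tm Γ A → Tm Γ (Weld P A T f)
      weld-nat : ∀ {Γ Δ} (σ : Sub Δ Γ) (P : PTy Γ) (A : Ty Γ) (T : Ty (Γ ▹ ty P))
                 (f : FTm (Γ ▹ ty P) (A [ π (ty P) ]T) T) (a : Tm Γ A) →
                 (weld P A T f a [ σ ]t)
                   ≅ᵗ weld (P [ σ ]P) (A [ σ ]T) (T [ lift σ (ty P) ]T) (f [ lift σ (ty P) ]F)
                           (a [ σ ]t)
      weld-⊤   : ∀ {Γ} (P : PTy Γ) (A : Ty Γ) (T : Ty (Γ ▹ ty P))
                 (f : FTm (Γ ▹ ty P) (A [ π (ty P) ]T) T) (p : Tm Γ (ty P)) (a : Tm Γ A) →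
                 weld P A T f a ≅ᵗ (f [ ⟨ idS , p ⟩ ]F $ a)

  module WeldAux₂ (WT : WeldType) (WM : WeldTm WT) where
    open WeldType WT
    open WeldTm WM

    weldξ : ∀ {Γ} (P : PTy Γ) (A : Ty Γ) (T : Ty (Γ ▹ ty P))
            (f : FTm (Γ ▹ ty P) (A [ π (ty P) ]T) T) → Tm (Γ ▹ A) (Weld P A T f [ π A ]T)
    weldξ P A T f =
      coeTm (≡ᵀ-sym (Weld-nat (π A) P A T f))
            (weld (P [ π A ]P) (A [ π A ]T) (T [ lift (π A) (ty P) ]T)
                  (f [ lift (π A) (ty P) ]F) (ξ A))

  record WeldInd (WT : WeldType) (WM : WeldTm WT) : Set₁ where
    open WeldType WT
    open WeldTm WM
    open WeldAux WT
    open WeldAux₂ WT WM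
    field
      ind : ∀ {Γ} (P : PTy Γ) (A : Ty Γ) (T : Ty (Γ ▹ ty P))
            (f : FTm (Γ ▹ ty P) (A [ π (ty P) ]T) T)
            (C : Ty (Γ ▹ Weld P A T f))
            (d : Tm (Γ ▹ ty P ▹ T) (C [ πP⁺ P A T f ]T))
            (c : Tm (Γ ▹ A) (C [ ⟨ π A , weldξ P A T f ⟩ ]T))
            (h : (d [ ⟨ π (A [ π (ty P) ]T) , f [ π (A [ π (ty P) ]T) ]F $ ξ (A [ π (ty P) ]T) ⟩ ]t)
                   ≅ᵗ (c [ lift (π (ty P)) A ]t))
            (b : Tm Γ (Weld P A T f)) →
            Tm Γ (C [ ⟨ idS , b ⟩ ]T)

      ind-nat : ∀ {Γ Δ} (σ : Sub Δ Γ) (P : PTy Γ) (A : Ty Γ) (T : Ty (Γ ▹ ty P))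
                (f : FTm (Γ ▹ ty P) (A [ π (ty P) ]T) T)
                (C : Ty (Γ ▹ Weld P A T f))
                (d : Tm (Γ ▹ ty P ▹ T) (C [ πP⁺ P A T f ]T))
                (c : Tm (Γ ▹ A) (C [ ⟨ π A , weldξ P A T f ⟩ ]T))
                (h : (d [ ⟨ π (A [ π (ty P) ]T) , f [ π (A [ π (ty P) ]T) ]F $ ξ (A [ π (ty P) ]T) ⟩ ]t)
                       ≅ᵗ (c [ lift (π (ty P)) A ]t))
                (b : Tm Γ (Weld P A T f)) →
                let P' = P [ σ ]P
                    A' = A [ σ ]T
                    T' = T [ lift σ (ty P) ]T
                    f' = f [ lift σ (ty P) ]F
                    C' = C [ liftE σ (Weld-nat σ P A T f) ]T
                in
                (d' : Tm (Δ ▹ ty P' ▹ T') (C' [ πP⁺ P' A' T' f' ]T)) →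
                d' ≅ᵗ (d [ lift (lift σ (ty P)) T ]t) →
                (c' : Tm (Δ ▹ A') (C' [ ⟨ π A' , weldξ P' A' T' f' ⟩ ]T)) →
                c' ≅ᵗ (c [ lift σ A ]t) →
                (h' : (d' [ ⟨ π (A' [ π (ty P') ]T) , f' [ π (A' [ π (ty P') ]T) ]F $ ξ (A' [ π (ty P') ]T) ⟩ ]t)
                        ≅ᵗ (c' [ lift (π (ty P')) A' ]t)) →
                (b' : Tm Δ (Weld P' A' T' f')) →
                b' ≅ᵗ (b [ σ ]t) →
                (ind P A T f C d c h b [ σ ]t) ≅ᵗ ind P' A' T' f' C' d' c' h' b'

      ind-⊤ : ∀ {Γ} (P : PTy Γ) (A : Ty Γ) (T : Ty (Γ ▹ ty P))
              (f : FTm (Γ ▹ ty P) (A [ π (ty P) ]T) T)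
              (C : Ty (Γ ▹ Weld P A T f))
              (d : Tm (Γ ▹ ty P ▹ T) (C [ πP⁺ P A T f ]T))
              (c : Tm (Γ ▹ A) (C [ ⟨ π A , weldξ P A T f ⟩ ]T))
              (h : (d [ ⟨ π (A [ π (ty P) ]T) , f [ π (A [ π (ty P) ]T) ]F $ ξ (A [ π (ty P) ]T) ⟩ ]t)
                     ≅ᵗ (c [ lift (π (ty P)) A ]t))
              (b : Tm Γ (Weld P A T f)) (p : Tm Γ (ty P)) →
              ind P A T f C d c h b ≅ᵗ (d [ ⟨ ⟨ idS , p ⟩ , coeTm (Weld-⊤ P A T f p) b ⟩ ]t)

      ind-β : ∀ {Γ} (P : PTy Γ) (A : Ty Γ) (T : Ty (Γ ▹ ty P))
              (f : FTm (Γ ▹ ty P) (A [ π (ty P) ]T) T)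
              (C : Ty (Γ ▹ Weld P A T f))
              (d : Tm (Γ ▹ ty P ▹ T) (C [ πP⁺ P A T f ]T))
              (c : Tm (Γ ▹ A) (C [ ⟨ π A , weldξ P A T f ⟩ ]T))
              (h : (d [ ⟨ π (A [ π (ty P) ]T) , f [ π (A [ π (ty P) ]T) ]F $ ξ (A [ π (ty P) ]T) ⟩ ]t)
                     ≅ᵗ (c [ lift (π (ty P)) A ]t))
              (a : Tm Γ A) →
              ind P A T f C d c h (weld P A T f a) ≅ᵗ (c [ ⟨ idS , a ⟩ ]t)

  SupportsWelding : Set₁
  SupportsWelding = Σ WeldType (λ WT → Σ (WeldTm WT) (λ WM → WeldInd WT WM))

module Submission where

-- Reasoning classically (LEM for propositions), the weld type
-- Ω = Weld{A ← (P ↪ T, f)} is defined fibrewise by cases on the proposition: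
--   Ω[γ] = T[γ, p]  if P[γ] holds (p its unique proof),   Ω[γ] = A[γ]  otherwise.
-- Restriction along φ is that of T or of A, except when P[γ] fails and P[γφ]
-- holds, where a ∈ A[γ] goes to f(a⟨φ⟩) ∈ T[γφ, p]; the fourth case (P[γ] holds,
-- P[γφ] fails) cannot occur because P is stable under restriction.  Likewise
-- weld a is a on the A-side and f a on the T-side, and ind_Weld is d on the
-- T-side and c on the A-side; the hypothesis d[(π, f ξ)] = c[π_P+] is exactly
-- what makes ind natural across the mixed restriction.
--
-- Every fibrewise definition is stated for an arbitrary decision of P[γ], so that
-- it can be defined by pattern matching, and then instantiated at the decision
-- given by LEM.  The file first proves transport lemmas for the presheaf CwF,
-- then constructs Ω with its ⊤-rule and naturality, then weld, then ind_Weld;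
-- the theorem packages the three constructions.

open import Defs
open import Data.Product using (_,_; proj₁)
open import Data.Empty using (⊥-elim)
open import Relation.Nullary using (Dec; yes; no; ¬_)
open import Relation.Nullary.Decidable using (recompute)
open import Relation.Binary.PropositionalEquality using (_≡_; refl; sym; trans; cong; subst)
open import Relation.Binary.HeterogeneousEquality as H using (_≅_; refl; ≅-to-≡; ≡-to-≅)
open import Axiom.UniquenessOfIdentityProofs.WithK using (uip)

coe-removable : {X Y : Set} (p : X ≡ Y) (x : X) → coe p x ≅ x
coe-removable = H.≡-subst-removable (λ X → X)

-- Congruence lemmas for the presheaf CwF, phrased with heterogeneous equality
-- because the fibres of a type depend on the point of the context.
module Transport (𝒲 : Category) where
  open Category 𝒲
  open PSh 𝒲

  fn-cong : ∀ {Γ} {A B : Ty Γ} {W} {γ : El Γ W} (g : FunEl A B γ) {V} {φ φ' : Hom V W}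
            (p : φ ≡ φ') {γ' : El Γ V} .(e : γ' ≡ rst Γ γ φ) .(e' : γ' ≡ rst Γ γ φ')
            (x : Fam A γ') → fn g φ e x ≡ fn g φ' e' x
  fn-cong g refl e e' x = refl

  res-cong : ∀ {Γ} (S : Ty Γ) {V W} {φ : Hom V W} {γ₁ γ₂ : El Γ W} (p : γ₁ ≡ γ₂)
             {γ'₁ γ'₂ : El Γ V} (p' : γ'₁ ≡ γ'₂) {x₁ : Fam S γ₁} {x₂ : Fam S γ₂} → x₁ ≅ x₂ →
             .(e₁ : γ'₁ ≡ rst Γ γ₁ φ) →
             res S φ e₁ x₁ ≅ res S φ (trans (sym p') (trans e₁ (cong (λ g → rst Γ g φ) p))) x₂
  res-cong S refl refl refl e₁ = refl

  tm-cong : ∀ {Γ} {S : Ty Γ} (t : Tm Γ S) {W} {γ₁ γ₂ : El Γ W} → γ₁ ≡ γ₂ → tm t γ₁ ≅ tm t γ₂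
  tm-cong t refl = refl

  pair-cong : ∀ {Γ} {S : Ty Γ} {W} {γ₁ γ₂ : El Γ W} → γ₁ ≡ γ₂ → {x₁ : Fam S γ₁} {x₂ : Fam S γ₂} →
              x₁ ≅ x₂ → _≡_ {A = El (Γ ▹ S) W} (γ₁ , x₁) (γ₂ , x₂)
  pair-cong refl refl = refl

  pair-res : ∀ {Γ} (S : Ty Γ) {V W} (φ : Hom V W) {γ : El Γ W} {γ' : El Γ V}
             (e : γ' ≡ rst Γ γ φ) (x : Fam S γ) →
             _≡_ {A = El (Γ ▹ S) V} (γ' , res S φ e x) (rst (Γ ▹ S) (γ , x) φ)
  pair-res S φ e x = pair-cong {S = S} e (res-cong S refl e refl e)

module Construction (𝒲 : Category) (lem : LEM) where
  open Category 𝒲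
  open PSh 𝒲
  open Transport 𝒲

  -- Equalities of points are propositions (UIP), so LEM makes an irrelevant
  -- equality proof available relevantly; needed to apply the naturality of f.
  relevant : {X : Set} {x y : X} → .(x ≡ y) → x ≡ y
  relevant {x = x} {y} = recompute (lem (x ≡ y) uip)

  module Welded {Γ : Ctx} (P : PTy Γ) (A : Ty Γ) (T : Ty (Γ ▹ ty P))
                  (f : FTm (Γ ▹ ty P) (A [ π (ty P) ]T) T) where
    Holds : ∀ {W} → El Γ W → Set
    Holds γ = Fam (ty P) γ

    decide : ∀ {W} (γ : El Γ W) → Dec (Holds γ)
    decide γ = lem (Holds γ) (prop P γ)

    Fibre : ∀ {W} (γ : El Γ W) → Dec (Holds γ) → Set
    Fibre γ (yes q) = Fam T (γ , q)
    Fibre γ (no _)  = Fam A γ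

    P-point : ∀ {W} {γ γ' : El Γ W} (e : γ ≡ γ') {q : Holds γ} {q' : Holds γ'} →
              _≡_ {A = El (Γ ▹ ty P) W} (γ , q) (γ' , q')
    P-point {γ = γ} refl {q} {q'} = cong (γ ,_) (prop P γ q q')

    apply : ∀ {W} (c : El (Γ ▹ ty P) W) → Fam A (proj₁ c) → Fam T c
    apply c a = fn (ftm f c) idH (sym (rst-id (Γ ▹ ty P) c)) a

    apply-cong : ∀ {W} {c₁ c₂ : El (Γ ▹ ty P) W} (p : c₁ ≡ c₂)
                 {x₁ : Fam A (proj₁ c₁)} {x₂ : Fam A (proj₁ c₂)} → x₁ ≅ x₂ → apply c₁ x₁ ≅ apply c₂ x₂
    apply-cong refl refl = refl

    apply-nat : ∀ {V W} (φ : Hom V W) {c : El (Γ ▹ ty P) W} {c' : El (Γ ▹ ty P) V}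
                (E : c' ≡ rst (Γ ▹ ty P) c φ) (x : Fam A (proj₁ c)) →
                res T φ E (apply c x) ≡ apply c' (res (A [ π (ty P) ]T) φ E x)
    apply-nat φ {c} {c'} E x =
      let ΓP = Γ ▹ ty P
          e₁ = trans E (cong (rst ΓP c) (sym (idˡ φ)))
          e₂ = trans E (cong (rst ΓP c) (sym (idʳ φ)))
          y  = res (A [ π (ty P) ]T) φ E x
      in trans (fnat (ftm f c) idH φ (sym (rst-id ΓP c)) E e₁ x)
         (trans (fn-cong (ftm f c) (idˡ φ) e₁ E y)
         (trans (fn-cong (ftm f c) (sym (idʳ φ)) E e₂ y)
                (sym (ftnat f φ E idH (sym (rst-id ΓP c')) e₂ y))))

    restrict : ∀ {V W} (φ : Hom V W) {γ : El Γ W} {γ' : El Γ V} .(e : γ' ≡ rst Γ γ φ)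
               (d : Dec (Holds γ)) (d' : Dec (Holds γ')) → Fibre γ d → Fibre γ' d'
    restrict φ e (yes q) (yes q') t = res T φ (P-point e) t
    restrict φ e (yes q) (no ¬q') t = ⊥-elim (¬q' (res (ty P) φ e q))
    restrict φ {γ' = γ'} e (no _) (yes q') a = apply (γ' , q') (res A φ e a)
    restrict φ e (no _) (no _) a = res A φ e a

    restrict-id : ∀ {W} {γ : El Γ W} .(e : γ ≡ rst Γ γ idH) (d : Dec (Holds γ)) (t : Fibre γ d) →
                  restrict idH e d d t ≡ t
    restrict-id e (yes q) t = res-id T (P-point e) t
    restrict-id e (no _) t = res-id A e t

    -- Functoriality; the mixed case A → A → T uses the naturality of f.
    restrict-∘ : ∀ {U V W} (φ : Hom V W) (ψ : Hom U V) {γ : El Γ W} {γ₁ : El Γ V} {γ₂ : El Γ U}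
                 .(e₁ : γ₁ ≡ rst Γ γ φ) .(e₂ : γ₂ ≡ rst Γ γ₁ ψ) .(e : γ₂ ≡ rst Γ γ (φ ∘ ψ))
                 (d : Dec (Holds γ)) (d₁ : Dec (Holds γ₁)) (d₂ : Dec (Holds γ₂)) (t : Fibre γ d) →
                 restrict (φ ∘ ψ) e d d₂ t ≡ restrict ψ e₂ d₁ d₂ (restrict φ e₁ d d₁ t)
    restrict-∘ φ ψ e₁ e₂ e (yes q) (yes q₁) (yes q₂) t = res-∘ T φ ψ (P-point e₁) (P-point e₂) (P-point e) t
    restrict-∘ φ ψ e₁ e₂ e (yes q) (yes q₁) (no ¬q₂) t = ⊥-elim (¬q₂ (res (ty P) ψ e₂ q₁))
    restrict-∘ φ ψ e₁ e₂ e (yes q) (no ¬q₁) d₂ t = ⊥-elim (¬q₁ (res (ty P) φ e₁ q))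
    restrict-∘ φ ψ e₁ e₂ e (no _) (yes q₁) (no ¬q₂) t = ⊥-elim (¬q₂ (res (ty P) ψ e₂ q₁))
    restrict-∘ φ ψ e₁ e₂ e (no _) (no _) (no _) t = res-∘ A φ ψ e₁ e₂ e t
    restrict-∘ φ ψ {γ₂ = γ₂} e₁ e₂ e (no _) (no _) (yes q₂) t =
      cong (apply (γ₂ , q₂)) (res-∘ A φ ψ e₁ e₂ e t)
    restrict-∘ φ ψ {γ₂ = γ₂} e₁ e₂ e (no _) (yes q₁) (yes q₂) t =
      trans (cong (apply (γ₂ , q₂)) (res-∘ A φ ψ e₁ e₂ e t))
            (sym (apply-nat ψ (relevant (P-point e₂)) (res A φ e₁ t)))

    Ω : Ty Γ
    Ω = record
      { Fam    = λ γ → Fibre γ (decide γ)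
      ; res    = λ φ e t → restrict φ e (decide _) (decide _) t
      ; res-id = λ e t → restrict-id e (decide _) t
      ; res-∘  = λ φ ψ e₁ e₂ e t → restrict-∘ φ ψ e₁ e₂ e (decide _) (decide _) (decide _) t
      }

    weldAt : ∀ {W} (γ : El Γ W) (d : Dec (Holds γ)) → Fam A γ → Fibre γ d
    weldAt γ (yes q) a = apply (γ , q) a
    weldAt γ (no _) a = a

    weldAt-nat : ∀ {V W} (φ : Hom V W) {γ : El Γ W} {γ' : El Γ V} (e : γ' ≡ rst Γ γ φ) (a : Tm Γ A)
                 (d : Dec (Holds γ)) (d' : Dec (Holds γ')) →
                 restrict φ e d d' (weldAt γ d (tm a γ)) ≡ weldAt γ' d' (tm a γ')
    weldAt-nat φ {γ} {γ'} e a (yes q) (yes q') =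
      trans (apply-nat φ (P-point e) (tm a γ)) (cong (apply (γ' , q')) (tnat a φ e))
    weldAt-nat φ e a (yes q) (no ¬q') = ⊥-elim (¬q' (res (ty P) φ e q))
    weldAt-nat φ {γ} {γ'} e a (no _) (yes q') = cong (apply (γ' , q')) (tnat a φ e)
    weldAt-nat φ e a (no _) (no _) = tnat a φ e

    weld : Tm Γ A → Tm Γ Ω
    weld a = record { tm   = λ γ → weldAt γ (decide γ) (tm a γ)
                    ; tnat = λ φ e → weldAt-nat φ e a (decide _) (decide _) }

    -- The ⊤-rules: when P has a global proof p, only the T-side occurs.
    module Trivial (p : Tm Γ (ty P)) where
      Fibre-⊤ : ∀ {W} (γ : El Γ W) (d : Dec (Holds γ)) → Fibre γ d ≡ Fam T (γ , tm p γ)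
      Fibre-⊤ γ (yes q) = cong (λ r → Fam T (γ , r)) (prop P γ q (tm p γ))
      Fibre-⊤ γ (no ¬q) = ⊥-elim (¬q (tm p γ))

      restrict-⊤ : ∀ {V W} (φ : Hom V W) {γ : El Γ W} {γ' : El Γ V} .(e : γ' ≡ rst Γ γ φ)
                   (d : Dec (Holds γ)) (d' : Dec (Holds γ')) (x : Fibre γ d) (y : Fam T (γ , tm p γ)) →
                   x ≅ y → .(e' : (γ' , tm p γ') ≡ rst (Γ ▹ ty P) (γ , tm p γ) φ) →
                   restrict φ e d d' x ≅ res T φ e' y
      restrict-⊤ φ e (yes q) (yes q') x y xy e' = res-cong T (P-point refl) (P-point refl) xy (P-point e)
      restrict-⊤ φ {γ' = γ'} e (yes q) (no ¬q') x y xy e' = ⊥-elim (¬q' (tm p γ'))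
      restrict-⊤ φ {γ = γ} e (no ¬q) d' x y xy e' = ⊥-elim (¬q (tm p γ))

      Ω-⊤ : Ω ≡ᵀ T [ ⟨ idS , p ⟩ ]T
      Ω-⊤ = record
        { Fam≡ = λ γ → Fibre-⊤ γ (decide γ)
        ; res≡ = λ φ {γ} {γ'} e x →
            ≅-to-≡ (H.trans (coe-removable (Fibre-⊤ γ' (decide γ')) _)
                   (restrict-⊤ φ e (decide γ) (decide γ') x _
                               (H.sym (coe-removable (Fibre-⊤ γ (decide γ)) x)) _))
        }

      weldAt-⊤ : ∀ {W} (γ : El Γ W) (d : Dec (Holds γ)) (a : Fam A γ) → weldAt γ d a ≅ apply (γ , tm p γ) a
      weldAt-⊤ γ (yes q) a = apply-cong (P-point refl) refl
      weldAt-⊤ γ (no ¬q) a = ⊥-elim (¬q (tm p γ))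

  -- Substitution σ does not change the decisions, so Ω and weld are natural on the nose.
  module WeldedSubst {Γ Δ : Ctx} (σ : Sub Δ Γ) (P : PTy Γ) (A : Ty Γ) (T : Ty (Γ ▹ ty P))
                       (f : FTm (Γ ▹ ty P) (A [ π (ty P) ]T) T) where
    module G = Welded P A T f
    module D = Welded (P [ σ ]P) (A [ σ ]T) (T [ lift σ (ty P) ]T) (f [ lift σ (ty P) ]F)

    Fibre-subst : ∀ {W} (δ : El Δ W) (d : Dec (G.Holds (ap σ δ))) → G.Fibre (ap σ δ) d ≡ D.Fibre δ d
    Fibre-subst δ (yes q) = refl
    Fibre-subst δ (no _) = refl

    restrict-subst : ∀ {V W} (φ : Hom V W) {δ : El Δ W} {δ' : El Δ V} .(e : δ' ≡ rst Δ δ φ)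
                     (d : Dec (G.Holds (ap σ δ))) (d' : Dec (G.Holds (ap σ δ')))
                     (x : G.Fibre (ap σ δ) d) (x' : D.Fibre δ d) → x ≅ x' →
                     G.restrict φ (trans (cong (ap σ) e) (snat σ δ φ)) d d' x ≅ D.restrict φ e d d' x'
    restrict-subst φ e (yes q) (yes q') x .x refl = refl
    restrict-subst φ e (yes q) (no ¬q') x .x refl =
      ⊥-elim (¬q' (res (ty P) φ (trans (cong (ap σ) e) (snat σ _ φ)) q))
    restrict-subst φ e (no _) (yes q') x .x refl = refl
    restrict-subst φ e (no _) (no _) x .x refl = refl

    Ω-subst : G.Ω [ σ ]T ≡ᵀ D.Ω
    Ω-subst = record
      { Fam≡ = λ δ → Fibre-subst δ (G.decide (ap σ δ))
      ; res≡ = λ φ {δ} {δ'} e x →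
          ≅-to-≡ (H.trans (coe-removable (Fibre-subst δ' (G.decide (ap σ δ'))) _)
                 (restrict-subst φ e (G.decide _) (G.decide _) x _
                                 (H.sym (coe-removable (Fibre-subst δ (G.decide (ap σ δ))) x))))
      }

    weldAt-subst : ∀ {W} (δ : El Δ W) (d : Dec (G.Holds (ap σ δ))) (a : Fam A (ap σ δ)) →
                   G.weldAt (ap σ δ) d a ≅ D.weldAt δ d a
    weldAt-subst δ (yes q) a = refl
    weldAt-subst δ (no _) a = refl

  weldType : WeldType
  weldType = record
    { Weld     = Welded.Ω
    ; Weld-nat = WeldedSubst.Ω-subst
    ; Weld-⊤   = λ P A T f p → Welded.Trivial.Ω-⊤ P A T f p }

  weldTm : WeldTm weldType
  weldTm = record
    { weld     = Welded.weld
    ; weld-nat = λ σ P A T f a δ →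
        WeldedSubst.weldAt-subst σ P A T f δ (Welded.decide P A T f (ap σ δ)) (tm a (ap σ δ))
    ; weld-⊤   = λ P A T f p a γ →
        Welded.Trivial.weldAt-⊤ P A T f p γ (Welded.decide P A T f γ) (tm a γ) }

  open WeldAux weldType
  open WeldAux₂ weldType weldTm

  module Induction {Γ : Ctx} (P : PTy Γ) (A : Ty Γ) (T : Ty (Γ ▹ ty P))
                   (f : FTm (Γ ▹ ty P) (A [ π (ty P) ]T) T)
                   (C : Ty (Γ ▹ Welded.Ω P A T f))
                   (d : Tm (Γ ▹ ty P ▹ T) (C [ πP⁺ P A T f ]T))
                   (c : Tm (Γ ▹ A) (C [ ⟨ π A , weldξ P A T f ⟩ ]T)) where
    open Welded P A T f

    weldξ-at : ∀ {W} (γ : El Γ W) (a : Fam A γ) (dd : Dec (Holds γ)) → dd ≡ decide γ →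
               tm (weldξ P A T f) (γ , a) ≅ weldAt γ dd a
    weldξ-at γ a .(decide γ) refl =
      H.trans (coe-removable _ _) (H.sym (WeldedSubst.weldAt-subst (π A) P A T f (γ , a) (decide γ) a))

    elim : ∀ {W} (γ : El Γ W) (dd : Dec (Holds γ)) (p : dd ≡ decide γ) (x : Fibre γ dd) →
           Fam C (γ , subst (Fibre γ) p x)
    elim γ (yes q) p x =
      subst (λ y → Fam C (γ , y))
            (≅-to-≡ (H.trans (coe-removable _ x) (H.sym (H.≡-subst-removable (Fibre γ) p x))))
            (tm d ((γ , q) , x))
    elim γ (no ¬q) p x =
      subst (λ y → Fam C (γ , y))
            (≅-to-≡ (H.trans (weldξ-at γ x (no ¬q) p) (H.sym (H.≡-subst-removable (Fibre γ) p x))))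
            (tm c (γ , x))

    elim-yes : ∀ {W} (γ : El Γ W) (q : Holds γ) (p : yes q ≡ decide γ) (x : Fibre γ (yes q)) →
               elim γ (yes q) p x ≅ tm d ((γ , q) , x)
    elim-yes γ q p x = H.≡-subst-removable (λ y → Fam C (γ , y)) _ _

    elim-no : ∀ {W} (γ : El Γ W) (¬q : ¬ Holds γ) (p : no ¬q ≡ decide γ) (x : Fibre γ (no ¬q)) →
              elim γ (no ¬q) p x ≅ tm c (γ , x)
    elim-no γ ¬q p x = H.≡-subst-removable (λ y → Fam C (γ , y)) _ _

    -- On the T-side, the point of Γ.Ω is the image of a point of Γ.P.T under π_P+.
    on-T-side : ∀ {W} (γ : El Γ W) (q : Holds γ) (p : yes q ≡ decide γ) (x : Fibre γ (yes q)) →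
                _≡_ {A = El (Γ ▹ Ω) W} (γ , subst (Fibre γ) p x)
                                        (γ , coe (sym (Fam≡ (Ω[π]≡T P A T f) (γ , q))) x)
    on-T-side γ q p x = pair-cong {S = Ω} refl (H.trans (H.≡-subst-removable (Fibre γ) p x)
                                                        (H.sym (coe-removable _ x)))

    -- On the A-side, a point of Γ.Ω is the image of a point of Γ.A under (π, weld ξ).
    on-A-side : ∀ {W} (γ : El Γ W) (a : Fam A γ) (dd : Dec (Holds γ)) (p : dd ≡ decide γ) →
                _≡_ {A = El (Γ ▹ Ω) W} (γ , subst (Fibre γ) p (weldAt γ dd a))
                                        (γ , tm (weldξ P A T f) (γ , a))
    on-A-side γ a dd p = pair-cong {S = Ω} refl (H.trans (H.≡-subst-removable (Fibre γ) p _)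
                                                 (H.sym (weldξ-at γ a dd p)))

    module Compatible
      (h : (d [ ⟨ π (A [ π (ty P) ]T) , f [ π (A [ π (ty P) ]T) ]F $ ξ (A [ π (ty P) ]T) ⟩ ]t)
             ≅ᵗ (c [ lift (π (ty P)) A ]t)) where

      -- Restricting elim's value in C is elim at the restricted point.  The
      -- mixed case (A-side above, T-side below) is where h is used.
      elim-nat : ∀ {V W} (φ : Hom V W) {γ : El Γ W} {γ' : El Γ V} (e : γ' ≡ rst Γ γ φ)
        (dd : Dec (Holds γ)) (p : dd ≡ decide γ) (dd' : Dec (Holds γ')) (p' : dd' ≡ decide γ')
        (x : Fibre γ dd)
        .(E : _≡_ {A = El (Γ ▹ Ω) V} (γ' , subst (Fibre γ') p' (restrict φ e dd dd' x))
                                      (rst (Γ ▹ Ω) (γ , subst (Fibre γ) p x) φ)) →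
        res C φ E (elim γ dd p x) ≅ elim γ' dd' p' (restrict φ e dd dd' x)
      elim-nat φ {γ} {γ'} e (yes q) p (yes q') p' x E =
        H.trans (res-cong C (on-T-side γ q p x) (on-T-side γ' q' p' x') (elim-yes γ q p x) E)
        (H.trans (≡-to-≅ (tnat d φ (pair-res T φ (P-point e) x)))
                 (H.sym (elim-yes γ' q' p' x')))
        where x' = res T φ (P-point e) x
      elim-nat φ e (yes q) p (no ¬q') p' x E = ⊥-elim (¬q' (res (ty P) φ e q))
      elim-nat φ {γ} {γ'} e (no ¬q) p (yes q') p' x E =
        H.trans (res-cong C (on-A-side γ x (no ¬q) p) (on-A-side γ' a' (yes q') p') (elim-no γ ¬q p x) E)
        (H.trans (≡-to-≅ (tnat c φ (pair-res A φ e x)))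
        (H.trans (H.sym (h ((γ' , q') , a')))
                 (H.sym (elim-yes γ' q' p' (apply (γ' , q') a')))))
        where a' = res A φ e x
      elim-nat φ {γ} {γ'} e (no ¬q) p (no ¬q') p' x E =
        H.trans (res-cong C (on-A-side γ x (no ¬q) p) (on-A-side γ' a' (no ¬q') p') (elim-no γ ¬q p x) E)
        (H.trans (≡-to-≅ (tnat c φ (pair-res A φ e x)))
                 (H.sym (elim-no γ' ¬q' p' a')))
        where a' = res A φ e x

      ind : (b : Tm Γ Ω) → Tm Γ (C [ ⟨ idS , b ⟩ ]T)
      ind b = record
        { tm   = λ γ → elim γ (decide γ) refl (tm b γ)
        ; tnat = λ φ {γ} {γ'} e → ≅-to-≡
            (H.trans (res-cong C refl (pair-cong {S = Ω} refl (≡-to-≅ (sym (tnat b φ e)))) refl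
                               (trans (cong (ap (⟨_,_⟩ {T = Ω} idS b)) e) (snat (⟨_,_⟩ {T = Ω} idS b) γ φ)))
            (H.trans (elim-nat φ e (decide γ) refl (decide γ') refl (tm b γ) _)
                     (H.cong (λ y → elim γ' (decide γ') refl y) (≡-to-≅ (tnat b φ e))))) }

      elim-⊤ : (p : Tm Γ (ty P)) → ∀ {W} (γ : El Γ W) (dd : Dec (Holds γ)) (pp : dd ≡ decide γ)
               (x : Fibre γ dd) (y : Fam T (γ , tm p γ)) → x ≅ y →
               elim γ dd pp x ≅ tm d ((γ , tm p γ) , y)
      elim-⊤ p γ (yes q) pp x y xy = H.trans (elim-yes γ q pp x) (tm-cong d (pair-cong {S = T} (P-point refl) xy))
      elim-⊤ p γ (no ¬q) pp x y xy = ⊥-elim (¬q (tm p γ))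

      -- β-rule: ind on weld a is c at (id, a); on the T-side this is h.
      elim-β : (a : Tm Γ A) → ∀ {W} (γ : El Γ W) (dd : Dec (Holds γ)) (pp : dd ≡ decide γ) →
               elim γ dd pp (weldAt γ dd (tm a γ)) ≅ tm c (γ , tm a γ)
      elim-β a γ (yes q) pp = H.trans (elim-yes γ q pp _) (h ((γ , q) , tm a γ))
      elim-β a γ (no ¬q) pp = elim-no γ ¬q pp _

  module InductionSubst {Γ Δ : Ctx} (σ : Sub Δ Γ) (P : PTy Γ) (A : Ty Γ) (T : Ty (Γ ▹ ty P))
                        (f : FTm (Γ ▹ ty P) (A [ π (ty P) ]T) T)
                        (C : Ty (Γ ▹ Welded.Ω P A T f))
                        (d : Tm (Γ ▹ ty P ▹ T) (C [ πP⁺ P A T f ]T))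
                        (c : Tm (Γ ▹ A) (C [ ⟨ π A , weldξ P A T f ⟩ ]T)) where
    P' : PTy Δ
    P' = P [ σ ]P
    A' : Ty Δ
    A' = A [ σ ]T
    T' : Ty (Δ ▹ ty P')
    T' = T [ lift σ (ty P) ]T
    f' : FTm (Δ ▹ ty P') (A' [ π (ty P') ]T) T'
    f' = f [ lift σ (ty P) ]F
    C' : Ty (Δ ▹ Welded.Ω P' A' T' f')
    C' = C [ liftE σ (WeldedSubst.Ω-subst σ P A T f) ]T
    module G = Welded P A T f
    module D = Welded P' A' T' f'
    module IG = Induction P A T f C d c

    elim-subst : (d' : Tm (Δ ▹ ty P' ▹ T') (C' [ πP⁺ P' A' T' f' ]T)) →
                 d' ≅ᵗ (d [ lift (lift σ (ty P)) T ]t) →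
                 (c' : Tm (Δ ▹ A') (C' [ ⟨ π A' , weldξ P' A' T' f' ⟩ ]T)) →
                 c' ≅ᵗ (c [ lift σ A ]t) →
                 ∀ {W} (δ : El Δ W) (dd : Dec (G.Holds (ap σ δ))) (pp : dd ≡ G.decide (ap σ δ))
                 (x : G.Fibre (ap σ δ) dd) (x' : D.Fibre δ dd) → x ≅ x' →
                 IG.elim (ap σ δ) dd pp x ≅ Induction.elim P' A' T' f' C' d' c' δ dd pp x'
    elim-subst d' hd c' hc δ (yes q) pp x .x refl =
      H.trans (IG.elim-yes _ q pp x)
              (H.trans (H.sym (hd ((δ , q) , x))) (H.sym (Induction.elim-yes P' A' T' f' C' d' c' δ q pp x)))
    elim-subst d' hd c' hc δ (no ¬q) pp x .x refl =
      H.trans (IG.elim-no _ ¬q pp x)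
              (H.trans (H.sym (hc (δ , x))) (H.sym (Induction.elim-no P' A' T' f' C' d' c' δ ¬q pp x)))

  weldInd : WeldInd weldType weldTm
  weldInd = record
    { ind     = λ P A T f C d c h b → Induction.Compatible.ind P A T f C d c h b
    ; ind-nat = λ σ P A T f C d c h b d' hd c' hc h' b' hb δ →
        InductionSubst.elim-subst σ P A T f C d c d' hd c' hc δ (Welded.decide P A T f (ap σ δ)) refl
                                  (tm b (ap σ δ)) (tm b' δ) (H.sym (hb δ))
    ; ind-⊤   = λ P A T f C d c h b p γ →
        Induction.Compatible.elim-⊤ P A T f C d c h p γ (Welded.decide P A T f γ) refl (tm b γ) _
                                    (H.sym (coe-removable _ (tm b γ)))
    ; ind-β   = λ P A T f C d c h a γ →
        Induction.Compatible.elim-β P A T f C d c h a γ (Welded.decide P A T f γ) refl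
    }

proposition1p15 : (𝒲 : Category) → LEM → PSh.SupportsWelding 𝒲
proposition1p15 𝒲 lem = weldType , weldTm , weldInd
  where open Construction 𝒲 lem
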